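{- For every integer $n \ge 4$, $\mathrm{bdim}(P_n) = \mathrm{bdim}(C_n) = \left\lfloor \frac{2n+2}{5} \right\rfloor$.
   Context: All graphs are finite, simple and undirected. $P_n$ and $C_n$ denote the path and the cycle on $n$ vertices. For vertices $x,y$ of a graph $G$, $d(x,y)$ is the length of a shortest $x$–$y$ path in $G$ ($\infty$ if $x,y$ lie in different components). For a positive integer $k$, let $d_k(x,y)=\min\{d(x,y),k+1\}$. A function $f:V(G)\to\mathbb{Z}_{\ge 0}$ is a resolving broadcast of $G$ if for any two distinct $x,y\in V(G)$ there is a vertex $z\in V(G)$ with $f(z)=i>0$ and $d_i(x,z)\neq d_i(y,z)$. The broadcast dimension $\mathrm{bdim}(G)$ is the minimum of $\sum_{v\in V(G)} f(v)$ over all resolving broadcasts $f$ of $G$. -}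

module Defs where

open import Data.Nat using (ℕ; zero; suc; _+_; _≤_; _<_; _∸_; s≤s)
open import Data.Fin using (Fin; toℕ)
open import Data.Product using (Σ; _×_; _,_; ∃)
open import Data.Sum using (_⊎_)
open import Relation.Nullary using (¬_)
open import Relation.Binary.PropositionalEquality using (_≡_; _≢_)

record Graph (n : ℕ) : Set₁ where
  field
    Adj     : Fin n → Fin n → Set
    adj-sym : ∀ {x y} → Adj x y → Adj y x
    adj-irr : ∀ {x} → ¬ Adj x x
open Graph public

data Walk {n : ℕ} (G : Graph n) : Fin n → Fin n → ℕ → Set where
  here : ∀ {x} → Walk G x x zero
  step : ∀ {x y z k} → Adj G x y → Walk G y z k → Walk G x z (suc k)

IsDist : ∀ {n} → Graph n → Fin n → Fin n → ℕ → Set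
IsDist G x y m = Walk G x y m × (∀ k → k < m → ¬ Walk G x y k)

-- d_i(x,y) = min{d(x,y), i+1} = m  (d = ∞ when no walk exists)
TDist : ∀ {n} → Graph n → ℕ → Fin n → Fin n → ℕ → Set
TDist G i x y m =
  (m ≤ i × IsDist G x y m)
  ⊎ (m ≡ suc i × (∀ k → k ≤ i → ¬ Walk G x y k))

sumFin : ∀ {n} → (Fin n → ℕ) → ℕ
sumFin {zero}  f = 0
sumFin {suc n} f = f Fin.zero + sumFin {n} (λ i → f (Fin.suc i))

Resolving : ∀ {n} → Graph n → (Fin n → ℕ) → Set
Resolving {n} G f =
  ∀ (x y : Fin n) → x ≢ y →
    Σ (Fin n) λ z → 0 < f z ×
      Σ ℕ λ a → Σ ℕ λ b →
        TDist G (f z) x z a × TDist G (f z) y z b × a ≢ b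

IsBdim : ∀ {n} → Graph n → ℕ → Set
IsBdim {n} G m =
  (Σ (Fin n → ℕ) λ f → Resolving G f × sumFin f ≡ m)
  × (∀ (f : Fin n → ℕ) → Resolving G f → m ≤ sumFin f)

PathAdj : ∀ {n} → Fin n → Fin n → Set
PathAdj i j = toℕ j ≡ suc (toℕ i) ⊎ toℕ i ≡ suc (toℕ j)

CycleAdj : ∀ {n} → Fin n → Fin n → Set
CycleAdj {n} i j =
  PathAdj i j
  ⊎ ((toℕ i ≡ 0 × toℕ j ≡ n ∸ 1) ⊎ (toℕ j ≡ 0 × toℕ i ≡ n ∸ 1))

private
  open import Data.Nat.Properties using (1+n≢n)
  open import Data.Sum using (inj₁; inj₂)
  open import Data.Empty using (⊥-elim)
  open import Relation.Binary.PropositionalEquality using (sym; trans)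

  pathSym : ∀ {n} {x y : Fin n} → PathAdj x y → PathAdj y x
  pathSym (inj₁ e) = inj₂ e
  pathSym (inj₂ e) = inj₁ e

  pathIrr : ∀ {n} {x : Fin n} → ¬ PathAdj x x
  pathIrr {x = x} (inj₁ e) = 1+n≢n (sym e)
  pathIrr {x = x} (inj₂ e) = 1+n≢n (sym e)

  cycSym : ∀ {n} {x y : Fin n} → CycleAdj x y → CycleAdj y x
  cycSym (inj₁ p) = inj₁ (pathSym p)
  cycSym (inj₂ (inj₁ (a , b))) = inj₂ (inj₂ (a , b))
  cycSym (inj₂ (inj₂ (a , b))) = inj₂ (inj₁ (a , b))

  three : ∀ {n} → 3 ≤ n → 0 ≢ n ∸ 1
  three (s≤s (s≤s _)) ()

  cycIrr : ∀ {n} → 3 ≤ n → {x : Fin n} → ¬ CycleAdj x x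
  cycIrr h (inj₁ p) = pathIrr p
  cycIrr h (inj₂ (inj₁ (a , b))) = three h (trans (sym a) b)
  cycIrr h (inj₂ (inj₂ (a , b))) = three h (trans (sym a) b)

pathGraph : (n : ℕ) → Graph n
pathGraph n = record { Adj = PathAdj ; adj-sym = pathSym ; adj-irr = pathIrr }

cycleGraph : (n : ℕ) → 3 ≤ n → Graph n
cycleGraph n h = record { Adj = CycleAdj ; adj-sym = cycSym ; adj-irr = cycIrr h }

-- Lower bound (module LowerBound), valid in every graph whose spheres have at
-- most two vertices.  Let f resolve, with weight s and k broadcasting vertices,
-- and say z hears x when d(x,z) ≤ f(z).  A ball of radius f(z) holds at most
-- 2f(z)+1 vertices, so the hearing relation has at most 2s + k pairs; at most one
-- vertex is heard by nobody; and the vertices whose only hearer is z have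
-- distinct distances to z, so there are at most s + k vertices heard once.
-- Charging 2 to every vertex gives 2n ≤ 3s + 2k + 2 ≤ 5s + 2.
-- Upper bound: an explicit 0/1 broadcast, reasoned about on the line (Pattern):
-- strength-1 broadcasters dominate all vertices but one and separate the two
-- neighbours of every broadcaster, which forces resolution.  Patterns for
-- 4 ≤ n ≤ 8 are verified by evaluation and extended by prepending 01010; as the
-- broadcasters avoid the ends, C_n looks like the line from each of them.

module Submission where

open import Defs
open import Data.Nat
open import Data.Nat.Properties
open import Data.Nat.DivMod using (m<n*o⇒m/o<n; m/n≡1+[m∸n]/n)
open import Data.Nat.Tactic.RingSolver using (solve-∀)
open import Data.Fin using (Fin; toℕ; fromℕ<) renaming (zero to fzero; suc to fsuc)
open import Data.Fin.Properties using (toℕ-injective; toℕ<n; toℕ-fromℕ<) renaming (_≟_ to _≟ᶠ_; suc-injective to fsuc-injective)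
open import Data.Product using (Σ; ∃; _×_; _,_; proj₁; proj₂)
open import Data.Sum using (_⊎_; inj₁; inj₂)
import Data.Sum
open import Data.Unit using (tt)
open import Data.Empty using (⊥; ⊥-elim)
open import Relation.Nullary using (¬_; Dec; yes; no; ¬?)
open import Relation.Nullary.Decidable using (_×-dec_; _→-dec_; True; toWitness)
open import Relation.Binary using (tri<; tri≈; tri>)
open import Relation.Binary.PropositionalEquality

sum-cong : ∀ {n} {f g : Fin n → ℕ} → (∀ i → f i ≡ g i) → sumFin f ≡ sumFin g
sum-cong {zero}  e = refl
sum-cong {suc n} e = cong₂ _+_ (e fzero) (sum-cong (λ i → e (fsuc i)))

sum-mono : ∀ {n} {f g : Fin n → ℕ} → (∀ i → f i ≤ g i) → sumFin f ≤ sumFin g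
sum-mono {zero}  e = z≤n
sum-mono {suc n} e = +-mono-≤ (e fzero) (sum-mono (λ i → e (fsuc i)))

sum-zero : ∀ {n} → sumFin {n} (λ _ → 0) ≡ 0
sum-zero {zero}  = refl
sum-zero {suc n} = sum-zero {n}

sum-const : ∀ {n} k → sumFin {n} (λ _ → k) ≡ n * k
sum-const {zero}  k = refl
sum-const {suc n} k = cong (k +_) (sum-const {n} k)

sum-+ : ∀ {n} (f g : Fin n → ℕ) → sumFin (λ i → f i + g i) ≡ sumFin f + sumFin g
sum-+ {zero}  f g = refl
sum-+ {suc n} f g =
  trans (cong (f fzero + g fzero +_) (sum-+ (λ i → f (fsuc i)) (λ i → g (fsuc i))))
        (interchange (f fzero) (g fzero) _ _)
  where
  interchange : ∀ a b c d → (a + b) + (c + d) ≡ (a + c) + (b + d)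
  interchange = solve-∀

sum-*ˡ : ∀ {n} k (f : Fin n → ℕ) → sumFin (λ i → k * f i) ≡ k * sumFin f
sum-*ˡ {zero}  k f = sym (*-zeroʳ k)
sum-*ˡ {suc n} k f =
  trans (cong (k * f fzero +_) (sum-*ˡ k (λ i → f (fsuc i))))
        (sym (*-distribˡ-+ k (f fzero) _))

sum-swap : ∀ {m n} (g : Fin m → Fin n → ℕ) →
  sumFin (λ x → sumFin (g x)) ≡ sumFin (λ z → sumFin (λ x → g x z))
sum-swap {zero}  {n} g = sym (sum-zero {n})
sum-swap {suc m} g =
  trans (cong (sumFin (g fzero) +_) (sum-swap (λ x → g (fsuc x))))
        (sym (sum-+ (g fzero) (λ z → sumFin (λ x → g (fsuc x) z))))

term≤sum : ∀ {n} (f : Fin n → ℕ) i → f i ≤ sumFin f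
term≤sum f fzero    = m≤m+n _ _
term≤sum f (fsuc i) = ≤-trans (term≤sum (λ j → f (fsuc j)) i) (m≤n+m _ _)

two-terms≤sum : ∀ {n} (f : Fin n → ℕ) i j → i ≢ j → f i + f j ≤ sumFin f
two-terms≤sum f fzero    fzero    i≢j = ⊥-elim (i≢j refl)
two-terms≤sum f fzero    (fsuc j) _   = +-monoʳ-≤ (f fzero) (term≤sum (λ k → f (fsuc k)) j)
two-terms≤sum f (fsuc i) fzero    _   =
  subst (_≤ sumFin f) (+-comm (f fzero) (f (fsuc i)))
        (+-monoʳ-≤ (f fzero) (term≤sum (λ k → f (fsuc k)) i))
two-terms≤sum f (fsuc i) (fsuc j) i≢j =
  ≤-trans (two-terms≤sum (λ k → f (fsuc k)) i j (λ e → i≢j (cong fsuc e))) (m≤n+m _ _)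

χ : ∀ {P : Set} → Dec P → ℕ
χ (yes _) = 1
χ (no _)  = 0

χ-yes : ∀ {P : Set} (d : Dec P) → P → χ d ≡ 1
χ-yes (yes _) _ = refl
χ-yes (no ¬p) p = ⊥-elim (¬p p)

χ-no : ∀ {P : Set} (d : Dec P) → ¬ P → χ d ≡ 0
χ-no (yes p) ¬p = ⊥-elim (¬p p)
χ-no (no _)  _  = refl

χ-mono : ∀ {P Q : Set} (d : Dec P) (e : Dec Q) → (P → Q) → χ d ≤ χ e
χ-mono (yes p) e P⇒Q = ≤-reflexive (sym (χ-yes e (P⇒Q p)))
χ-mono (no _)  e P⇒Q = z≤n

χ-⊎ : ∀ {P Q R : Set} (d : Dec P) (e : Dec Q) (g : Dec R) → (P → Q ⊎ R) → χ d ≤ χ e + χ g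
χ-⊎ (no _)  e g split = z≤n
χ-⊎ (yes p) e g split with split p
... | inj₁ q = ≤-trans (≤-reflexive (sym (χ-yes e q))) (m≤m+n _ _)
... | inj₂ r = ≤-trans (≤-reflexive (sym (χ-yes g r))) (m≤n+m _ _)

χ-× : ∀ {A B : Set} (d : Dec A) (e : Dec B) → χ (d ×-dec e) ≡ χ d * χ e
χ-× (yes _) (yes _) = refl
χ-× (yes _) (no _)  = refl
χ-× (no _)  (yes _) = refl
χ-× (no _)  (no _)  = refl

count : ∀ {n} {P : Fin n → Set} → (∀ x → Dec (P x)) → ℕ
count P? = sumFin (λ x → χ (P? x))

count-none : ∀ {n} {P : Fin n → Set} (P? : ∀ x → Dec (P x)) → (∀ x → ¬ P x) → count P? ≡ 0
count-none {n} P? none = trans (sum-cong (λ x → χ-no (P? x) (none x))) (sum-zero {n})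

Unique : ∀ {n} → (Fin n → Set) → Set
Unique P = ∀ x y → P x → P y → x ≡ y

count≤1 : ∀ {n} {P : Fin n → Set} (P? : ∀ x → Dec (P x)) → Unique P → count P? ≤ 1
count≤1 {zero}  P? unique = z≤n
count≤1 {suc n} P? unique with P? fzero
... | yes p = ≤-reflexive (cong suc (count-none (λ x → P? (fsuc x)) (λ x q → 0≢suc (unique _ _ p q))))
  where
  0≢suc : ∀ {x} → fzero ≢ fsuc x
  0≢suc ()
... | no _  = count≤1 (λ x → P? (fsuc x)) (λ x y px py → fsuc-injective (unique _ _ px py))

AtMostTwo : ∀ {n} → (Fin n → Set) → Set
AtMostTwo P = ∀ x y w → P x → P y → P w → x ≡ y ⊎ x ≡ w ⊎ y ≡ w

count≤2 : ∀ {n} {P : Fin n → Set} (P? : ∀ x → Dec (P x)) → AtMostTwo P → count P? ≤ 2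
count≤2 {zero}  P? two = z≤n
count≤2 {suc n} {P} P? two with P? fzero
... | yes p = s≤s (count≤1 (λ x → P? (fsuc x)) unique)
  where
  unique : Unique (λ x → P (fsuc x))
  unique x y px py with two fzero (fsuc x) (fsuc y) p px py
  ... | inj₁ ()
  ... | inj₂ (inj₁ ())
  ... | inj₂ (inj₂ e) = fsuc-injective e
... | no _  = count≤2 (λ x → P? (fsuc x)) two′
  where
  two′ : AtMostTwo (λ x → P (fsuc x))
  two′ x y w px py pw with two (fsuc x) (fsuc y) (fsuc w) px py pw
  ... | inj₁ e          = inj₁ (fsuc-injective e)
  ... | inj₂ (inj₁ e)   = inj₂ (inj₁ (fsuc-injective e))
  ... | inj₂ (inj₂ e)   = inj₂ (inj₂ (fsuc-injective e))

≤suc⇒≤⊎≡ : ∀ {k r} → k ≤ suc r → k ≤ r ⊎ k ≡ suc r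
≤suc⇒≤⊎≡ k≤1+r with m≤n⇒m<n∨m≡n k≤1+r
... | inj₁ k<1+r = inj₁ (≤-pred k<1+r)
... | inj₂ k≡1+r = inj₂ k≡1+r

count-injective-level : ∀ {n} {P : Fin n → Set} (P? : ∀ x → Dec (P x)) (K : Fin n → ℕ) →
  (∀ x y → P x → P y → K x ≡ K y → x ≡ y) →
  ∀ r → count (λ x → P? x ×-dec (K x ≤? r)) ≤ suc r
count-injective-level P? K inj zero =
  count≤1 (λ x → P? x ×-dec (K x ≤? 0))
    (λ { x y (px , kx) (py , ky) → inj x y px py (trans (n≤0⇒n≡0 kx) (sym (n≤0⇒n≡0 ky))) })
count-injective-level {P = P} P? K inj (suc r) = begin
  count (λ x → P? x ×-dec (K x ≤? suc r))
    ≤⟨ sum-mono (λ x → χ-⊎ (P? x ×-dec (K x ≤? suc r)) (P? x ×-dec (K x ≤? r)) (P? x ×-dec (K x ≟ suc r)) split) ⟩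
  sumFin (λ x → χ (P? x ×-dec (K x ≤? r)) + χ (P? x ×-dec (K x ≟ suc r)))
    ≡⟨ sum-+ (λ x → χ (P? x ×-dec (K x ≤? r))) (λ x → χ (P? x ×-dec (K x ≟ suc r))) ⟩
  count (λ x → P? x ×-dec (K x ≤? r)) + count (λ x → P? x ×-dec (K x ≟ suc r))
    ≤⟨ +-mono-≤ (count-injective-level P? K inj r) (count≤1 (λ x → P? x ×-dec (K x ≟ suc r)) top-unique) ⟩
  suc r + 1
    ≡⟨ +-comm (suc r) 1 ⟩
  suc (suc r) ∎
  where
  open ≤-Reasoning
  split : ∀ {x} → P x × K x ≤ suc r → (P x × K x ≤ r) ⊎ (P x × K x ≡ suc r)
  split (p , le) with ≤suc⇒≤⊎≡ le
  ... | inj₁ k≤r   = inj₁ (p , k≤r)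
  ... | inj₂ k≡1+r = inj₂ (p , k≡1+r)
  top-unique : ∀ x y → P x × K x ≡ suc r → P y × K y ≡ suc r → x ≡ y
  top-unique x y (px , kx) (py , ky) = inj x y px py (trans kx (sym ky))

count-two-per-level : ∀ {n} (K : Fin n → ℕ) →
  (∀ x y → K x ≡ 0 → K y ≡ 0 → x ≡ y) → (∀ d → AtMostTwo (λ x → K x ≡ d)) →
  ∀ r → count (λ x → K x ≤? r) ≤ suc (2 * r)
count-two-per-level K zero-unique two zero =
  count≤1 (λ x → K x ≤? 0) (λ x y kx ky → zero-unique x y (n≤0⇒n≡0 kx) (n≤0⇒n≡0 ky))
count-two-per-level K zero-unique two (suc r) = begin
  count (λ x → K x ≤? suc r)
    ≤⟨ sum-mono (λ x → χ-⊎ (K x ≤? suc r) (K x ≤? r) (K x ≟ suc r) ≤suc⇒≤⊎≡) ⟩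
  sumFin (λ x → χ (K x ≤? r) + χ (K x ≟ suc r))
    ≡⟨ sum-+ (λ x → χ (K x ≤? r)) (λ x → χ (K x ≟ suc r)) ⟩
  count (λ x → K x ≤? r) + count (λ x → K x ≟ suc r)
    ≤⟨ +-mono-≤ (count-two-per-level K zero-unique two r) (count≤2 (λ x → K x ≟ suc r) (two (suc r))) ⟩
  suc (2 * r) + 2
    ≡⟨ arith r ⟩
  suc (2 * suc r) ∎
  where
  open ≤-Reasoning
  arith : ∀ r → suc (2 * r) + 2 ≡ suc (2 * suc r)
  arith = solve-∀

-- Graph distances and truncated distances

record GraphDistance {n : ℕ} (G : Graph n) : Set where
  field
    dist     : Fin n → Fin n → ℕ
    walk     : ∀ x z → Walk G x z (dist x z)
    shortest : ∀ {x z k} → Walk G x z k → dist x z ≤ k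

  dist≡0⇒≡ : ∀ x z → dist x z ≡ 0 → x ≡ z
  dist≡0⇒≡ x z e = walk-length-0 (subst (Walk G x z) e (walk x z))
    where
    walk-length-0 : ∀ {x z} → Walk G x z 0 → x ≡ z
    walk-length-0 here = refl

  truncated : ∀ i x z → TDist G i x z (dist x z ⊓ suc i)
  truncated i x z with dist x z ≤? i
  ... | yes d≤i = inj₁ (subst (_≤ i) (sym d⊓) d≤i , subst (Walk G x z) (sym d⊓) (walk x z) ,
                        λ k k<d w → <⇒≱ (subst (k <_) d⊓ k<d) (shortest w))
    where
    d⊓ : dist x z ⊓ suc i ≡ dist x z
    d⊓ = m≤n⇒m⊓n≡m (m≤n⇒m≤1+n d≤i)
  ... | no d≰i  = inj₂ (m≥n⇒m⊓n≡n (≰⇒> d≰i) , λ k k≤i w → d≰i (≤-trans (shortest w) k≤i))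

  truncated-unique : ∀ i x z a → TDist G i x z a → a ≡ dist x z ⊓ suc i
  truncated-unique i x z a (inj₁ (a≤i , w , no-shorter)) with <-cmp a (dist x z)
  ... | tri< a<d _ _ = ⊥-elim (<⇒≱ a<d (shortest w))
  ... | tri≈ _ a≡d _ = trans a≡d (sym (m≤n⇒m⊓n≡m (subst (_≤ suc i) a≡d (m≤n⇒m≤1+n a≤i))))
  ... | tri> _ _ d<a = ⊥-elim (no-shorter (dist x z) d<a (walk x z))
  truncated-unique i x z a (inj₂ (a≡1+i , no-walk)) = trans a≡1+i (sym (m≥n⇒m⊓n≡n i<d))
    where
    i<d : suc i ≤ dist x z
    i<d with suc i ≤? dist x z
    ... | yes i<d = i<d
    ... | no  i≮d = ⊥-elim (no-walk (dist x z) (≤-pred (≰⇒> i≮d)) (walk x z))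

SmallSpheres : ∀ {n} {G : Graph n} → GraphDistance G → Set
SmallSpheres D = ∀ z d → AtMostTwo (λ x → GraphDistance.dist D x z ≡ d)

module LowerBound {n : ℕ} {G : Graph n} (D : GraphDistance G) (spheres : SmallSpheres D)
                  (f : Fin n → ℕ) (resolving : Resolving G f) where
  open GraphDistance D

  Hears : Fin n → Fin n → Set
  Hears z x = 1 ≤ f z × dist x z ≤ f z

  hears? : ∀ z x → Dec (Hears z x)
  hears? z x = (1 ≤? f z) ×-dec (dist x z ≤? f z)

  hearers : Fin n → ℕ
  hearers x = count (λ z → hears? z x)

  weight broadcasters : ℕ
  weight       = sumFin f
  broadcasters = count (λ z → 1 ≤? f z)

  out-of-range : ∀ z x → 1 ≤ f z → ¬ Hears z x → f z < dist x z
  out-of-range z x 1≤fz ¬hears with dist x z ≤? f z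
  ... | yes d≤fz = ⊥-elim (¬hears (1≤fz , d≤fz))
  ... | no  d≰fz = ≰⇒> d≰fz

  resolved : ∀ x y → x ≢ y →
    ¬ (∀ z → 1 ≤ f z → dist x z ≡ dist y z ⊎ (f z < dist x z × f z < dist y z))
  resolved x y x≢y same with resolving x y x≢y
  ... | z , 0<fz , a , b , ta , tb , a≢b =
    a≢b (trans (truncated-unique (f z) x z a ta)
        (trans (equal-caps (same z 0<fz)) (sym (truncated-unique (f z) y z b tb))))
    where
    equal-caps : ∀ {p q} → p ≡ q ⊎ (f z < p × f z < q) → p ⊓ suc (f z) ≡ q ⊓ suc (f z)
    equal-caps (inj₁ p≡q)         = cong (_⊓ suc (f z)) p≡q
    equal-caps (inj₂ (fz<p , fz<q)) = trans (m≥n⇒m⊓n≡n fz<p) (sym (m≥n⇒m⊓n≡n fz<q))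

  unheard : ∀ x z → hearers x ≡ 0 → ¬ Hears z x
  unheard x z none hz = 1+n≰n (begin
    1             ≡⟨ χ-yes (hears? z x) hz ⟨
    χ (hears? z x) ≤⟨ term≤sum (λ z → χ (hears? z x)) z ⟩
    hearers x     ≡⟨ none ⟩
    0             ∎)
    where open ≤-Reasoning

  unheard-unique : ∀ x y → hearers x ≡ 0 → hearers y ≡ 0 → x ≡ y
  unheard-unique x y hx hy with x ≟ᶠ y
  ... | yes x≡y = x≡y
  ... | no  x≢y = ⊥-elim (resolved x y x≢y (λ z 1≤fz →
          inj₂ (out-of-range z x 1≤fz (unheard x z hx) , out-of-range z y 1≤fz (unheard y z hy))))

  heard-once : ∀ x z w → hearers x ≡ 1 → Hears z x → z ≢ w → ¬ Hears w x
  heard-once x z w once hz z≢w hw = 1+n≰n (begin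
    2                                ≡⟨ cong₂ _+_ (χ-yes (hears? z x) hz) (χ-yes (hears? w x) hw) ⟨
    χ (hears? z x) + χ (hears? w x)  ≤⟨ two-terms≤sum (λ z → χ (hears? z x)) z w z≢w ⟩
    hearers x                        ≡⟨ once ⟩
    1                                ∎)
    where open ≤-Reasoning

  SoleHearer : Fin n → Fin n → Set
  SoleHearer z x = Hears z x × hearers x ≡ 1

  sole? : ∀ z x → Dec (SoleHearer z x)
  sole? z x = hears? z x ×-dec (hearers x ≟ 1)

  -- Vertices with the same sole hearer z are told apart by z alone, so by distance to z.
  sole-injective : ∀ z x y → SoleHearer z x → SoleHearer z y → dist x z ≡ dist y z → x ≡ y
  sole-injective z x y (hx , ox) (hy , oy) same-dist with x ≟ᶠ y
  ... | yes x≡y = x≡y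
  ... | no  x≢y = ⊥-elim (resolved x y x≢y same)
    where
    same : ∀ w → 1 ≤ f w → dist x w ≡ dist y w ⊎ (f w < dist x w × f w < dist y w)
    same w 1≤fw with z ≟ᶠ w
    ... | yes refl = inj₁ same-dist
    ... | no  z≢w  = inj₂ ( out-of-range w x 1≤fw (heard-once x z w ox hx z≢w)
                          , out-of-range w y 1≤fw (heard-once y z w oy hy z≢w))

  ball-size : ∀ z → count (λ x → hears? z x) ≤ 2 * f z + χ (1 ≤? f z)
  ball-size z = by-cases (1 ≤? f z)
    where
    open ≤-Reasoning
    by-cases : Dec (1 ≤ f z) → count (λ x → hears? z x) ≤ 2 * f z + χ (1 ≤? f z)
    by-cases (no ¬b) = ≤-trans (≤-reflexive (count-none (λ x → hears? z x) (λ x h → ¬b (proj₁ h)))) z≤n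
    by-cases (yes b) = begin
      count (λ x → hears? z x)      ≤⟨ sum-mono (λ x → χ-mono (hears? z x) (dist x z ≤? f z) proj₂) ⟩
      count (λ x → dist x z ≤? f z) ≤⟨ count-two-per-level (λ x → dist x z)
                                       (λ x y ex ey → trans (dist≡0⇒≡ x z ex) (sym (dist≡0⇒≡ y z ey)))
                                       (spheres z) (f z) ⟩
      suc (2 * f z)                 ≡⟨ +-comm 1 (2 * f z) ⟩
      2 * f z + 1                   ≡⟨ cong (2 * f z +_) (χ-yes (1 ≤? f z) b) ⟨
      2 * f z + χ (1 ≤? f z)        ∎

  sole-count : ∀ z → count (λ x → sole? z x) ≤ f z + χ (1 ≤? f z)
  sole-count z = by-cases (1 ≤? f z)
    where
    open ≤-Reasoning
    by-cases : Dec (1 ≤ f z) → count (λ x → sole? z x) ≤ f z + χ (1 ≤? f z)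
    by-cases (no ¬b) = ≤-trans (≤-reflexive (count-none (λ x → sole? z x) (λ x h → ¬b (proj₁ (proj₁ h))))) z≤n
    by-cases (yes b) = begin
      count (λ x → sole? z x)
        ≤⟨ sum-mono (λ x → χ-mono (sole? z x) (sole? z x ×-dec (dist x z ≤? f z)) (λ s → s , proj₂ (proj₁ s))) ⟩
      count (λ x → sole? z x ×-dec (dist x z ≤? f z))
        ≤⟨ count-injective-level (sole? z) (λ x → dist x z) (sole-injective z) (f z) ⟩
      suc (f z)          ≡⟨ +-comm 1 (f z) ⟩
      f z + 1            ≡⟨ cong (f z +_) (χ-yes (1 ≤? f z) b) ⟨
      f z + χ (1 ≤? f z) ∎

  hearing-total : sumFin hearers ≤ 2 * weight + broadcasters
  hearing-total = begin
    sumFin hearers                                 ≡⟨ sum-swap (λ x z → χ (hears? z x)) ⟩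
    sumFin (λ z → count (λ x → hears? z x))        ≤⟨ sum-mono ball-size ⟩
    sumFin (λ z → 2 * f z + χ (1 ≤? f z))          ≡⟨ sum-+ (λ z → 2 * f z) (λ z → χ (1 ≤? f z)) ⟩
    sumFin (λ z → 2 * f z) + broadcasters          ≡⟨ cong (_+ broadcasters) (sum-*ˡ 2 f) ⟩
    2 * weight + broadcasters                      ∎
    where open ≤-Reasoning

  heard-once-total : count (λ x → hearers x ≟ 1) ≤ weight + broadcasters
  heard-once-total = begin
    count (λ x → hearers x ≟ 1)                    ≤⟨ sum-mono has-sole-hearer ⟩
    sumFin (λ x → count (λ z → sole? z x))         ≡⟨ sum-swap (λ x z → χ (sole? z x)) ⟩
    sumFin (λ z → count (λ x → sole? z x))         ≤⟨ sum-mono sole-count ⟩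
    sumFin (λ z → f z + χ (1 ≤? f z))              ≡⟨ sum-+ f (λ z → χ (1 ≤? f z)) ⟩
    weight + broadcasters                          ∎
    where
    open ≤-Reasoning
    has-sole-hearer : ∀ x → χ (hearers x ≟ 1) ≤ count (λ z → sole? z x)
    has-sole-hearer x with hearers x ≟ 1
    ... | no _     = z≤n
    ... | yes once = ≤-reflexive (sym (trans
            (sum-cong (λ z → trans (χ-× (hears? z x) (yes once)) (*-identityʳ _))) once))

  broadcasters≤weight : broadcasters ≤ weight
  broadcasters≤weight = sum-mono (λ z → indicator≤ (f z))
    where
    indicator≤ : ∀ m → χ (1 ≤? m) ≤ m
    indicator≤ zero    = z≤n
    indicator≤ (suc m) = s≤s z≤n

  -- Each vertex x has 2 ≤ h(x) + [h(x) = 1] + 2 [h(x) = 0] with h = hearers;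
  -- summing over x and bounding the three sums gives 2n ≤ (2s + k) + (s + k) + 2.
  double-count : 2 * n ≤ (2 * weight + broadcasters) + (weight + broadcasters) + 2 * 1
  double-count = begin
    2 * n                                         ≡⟨ *-comm 2 n ⟩
    n * 2                                         ≡⟨ sum-const {n} 2 ⟨
    sumFin {n} (λ _ → 2)                          ≤⟨ sum-mono (λ x → two≤ (hearers x)) ⟩
    sumFin (λ x → hearers x + χ (hearers x ≟ 1) + 2 * χ (hearers x ≟ 0))
      ≡⟨ sum-+ (λ x → hearers x + χ (hearers x ≟ 1)) (λ x → 2 * χ (hearers x ≟ 0)) ⟩
    sumFin (λ x → hearers x + χ (hearers x ≟ 1)) + sumFin (λ x → 2 * χ (hearers x ≟ 0))
      ≡⟨ cong₂ _+_ (sum-+ hearers (λ x → χ (hearers x ≟ 1))) (sum-*ˡ 2 (λ x → χ (hearers x ≟ 0))) ⟩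
    sumFin hearers + count (λ x → hearers x ≟ 1) + 2 * count (λ x → hearers x ≟ 0)
      ≤⟨ +-mono-≤ (+-mono-≤ hearing-total heard-once-total)
                  (*-monoʳ-≤ 2 (count≤1 (λ x → hearers x ≟ 0) unheard-unique)) ⟩
    (2 * weight + broadcasters) + (weight + broadcasters) + 2 * 1 ∎
    where
    open ≤-Reasoning
    two≤ : ∀ m → 2 ≤ m + χ (m ≟ 1) + 2 * χ (m ≟ 0)
    two≤ zero          = s≤s (s≤s z≤n)
    two≤ (suc zero)    = s≤s (s≤s z≤n)
    two≤ (suc (suc m)) = s≤s (s≤s z≤n)

  -- 2n ≤ 3s + 2k + 2 ≤ 5s + 2 yields s ≥ ⌊(2n+2)/5⌋
  lower-bound : (2 * n + 2) / 5 ≤ weight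
  lower-bound = ≤-pred (m<n*o⇒m/o<n (begin-strict
    2 * n + 2                    ≤⟨ +-monoˡ-≤ 2 double-count ⟩
    (2 * s + k) + (s + k) + 2 * 1 + 2 ≡⟨ collect s k ⟩
    3 * s + 4 + 2 * k            ≤⟨ +-monoʳ-≤ (3 * s + 4) (*-monoʳ-≤ 2 broadcasters≤weight) ⟩
    3 * s + 4 + 2 * s            <⟨ n<1+n _ ⟩
    suc (3 * s + 4 + 2 * s)      ≡⟨ arith s ⟩
    suc s * 5                    ∎))
    where
    open ≤-Reasoning
    s k : ℕ
    s = weight
    k = broadcasters
    collect : ∀ s k → (2 * s + k) + (s + k) + 2 * 1 + 2 ≡ 3 * s + 4 + 2 * k
    collect = solve-∀
    arith : ∀ s → suc (3 * s + 4 + 2 * s) ≡ suc s * 5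
    arith = solve-∀

∣-∣-cases : ∀ a b → a ≡ b + ∣ a - b ∣ ⊎ a + ∣ a - b ∣ ≡ b
∣-∣-cases zero    b       = inj₂ refl
∣-∣-cases (suc a) zero    = inj₁ refl
∣-∣-cases (suc a) (suc b) = Data.Sum.map (cong suc) (cong suc) (∣-∣-cases a b)

∣-∣<n : ∀ {a b n} → a < n → b < n → ∣ a - b ∣ < n
∣-∣<n {a} {b} a<n b<n with ∣-∣-cases a b
... | inj₁ e = ≤-trans (s≤s (≤-trans (m≤n+m _ b) (≤-reflexive (sym e)))) a<n
... | inj₂ e = ≤-trans (s≤s (≤-trans (m≤n+m _ a) (≤-reflexive e))) b<n

∣suc-∣≡1 : ∀ a → ∣ suc a - a ∣ ≡ 1
∣suc-∣≡1 zero    = refl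
∣suc-∣≡1 (suc a) = ∣suc-∣≡1 a

path-edge-length : ∀ {n} {x y : Fin n} → PathAdj x y → ∣ toℕ x - toℕ y ∣ ≡ 1
path-edge-length {x = x} {y} (inj₁ y≡1+x) = trans (cong ∣ toℕ x -_∣ y≡1+x) (trans (∣-∣-comm (toℕ x) _) (∣suc-∣≡1 (toℕ x)))
path-edge-length {x = x} {y} (inj₂ x≡1+y) = trans (cong ∣_- toℕ y ∣ x≡1+y) (∣suc-∣≡1 (toℕ y))

∣-∣-step : ∀ a b c → ∣ a - b ∣ ≡ 1 → ∣ a - c ∣ ≤ suc ∣ b - c ∣
∣-∣-step a b c ab≡1 = subst (λ t → ∣ a - c ∣ ≤ t + ∣ b - c ∣) ab≡1 (∣-∣-triangle a b c)

module Walks {n : ℕ} (G : Graph n) where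

  _++ʷ_ : ∀ {x y z a b} → Walk G x y a → Walk G y z b → Walk G x z (a + b)
  here       ++ʷ w = w
  step e v   ++ʷ w = step e (v ++ʷ w)

  reverse : ∀ {x y k} → Walk G x y k → Walk G y x k
  reverse here = here
  reverse {k = suc k} (step e w) =
    subst (Walk G _ _) (+-comm k 1) (reverse w ++ʷ step (adj-sym G e) here)

  walk-bound : (D : Fin n → Fin n → ℕ) → (∀ z → D z z ≡ 0) →
    (∀ {x y} z → Adj G x y → D x z ≤ suc (D y z)) →
    ∀ {x z k} → Walk G x z k → D x z ≤ k
  walk-bound D diag lip {x} here = ≤-reflexive (diag x)
  walk-bound D diag lip {z = z} (step e w) = ≤-trans (lip z e) (s≤s (walk-bound D diag lip w))

  module PathEdges (path-edge : ∀ {x y} → PathAdj x y → Adj G x y) where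

    climb : ∀ k (x y : Fin n) → toℕ y ≡ toℕ x + k → Walk G x y k
    climb zero    x y e = subst (λ y → Walk G x y 0) (toℕ-injective (trans (sym (+-identityʳ (toℕ x))) (sym e))) here
    climb (suc k) x y e = step (path-edge (inj₁ (toℕ-fromℕ< next<n))) (climb k (fromℕ< next<n) y e′)
      where
      next<n : suc (toℕ x) < n
      next<n = ≤-trans (s≤s (≤-trans (m<m+n (toℕ x) (s≤s z≤n)) (≤-reflexive (sym e)))) (toℕ<n y)
      e′ : toℕ y ≡ toℕ (fromℕ< next<n) + k
      e′ = trans e (trans (+-suc (toℕ x) k) (cong (_+ k) (sym (toℕ-fromℕ< next<n))))

    straight : ∀ x z → Walk G x z ∣ toℕ x - toℕ z ∣
    straight x z with ∣-∣-cases (toℕ x) (toℕ z)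
    ... | inj₂ e = climb _ x z (sym e)
    ... | inj₁ e = reverse (climb _ z x e)

two-classes : ∀ {n} {P A B : Fin n → Set} → (∀ x → P x → A x ⊎ B x) → Unique A → Unique B → AtMostTwo P
two-classes {A = A} {B} cover uA uB x y w px py pw = pick (cover x px) (cover y py) (cover w pw)
  where
  pick : A x ⊎ B x → A y ⊎ B y → A w ⊎ B w → x ≡ y ⊎ x ≡ w ⊎ y ≡ w
  pick (inj₁ a) (inj₁ b) _        = inj₁ (uA x y a b)
  pick (inj₂ a) (inj₂ b) _        = inj₁ (uB x y a b)
  pick (inj₁ a) (inj₂ b) (inj₁ c) = inj₂ (inj₁ (uA x w a c))
  pick (inj₁ a) (inj₂ b) (inj₂ c) = inj₂ (inj₂ (uB y w b c))
  pick (inj₂ a) (inj₁ b) (inj₁ c) = inj₂ (inj₂ (uA y w b c))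
  pick (inj₂ a) (inj₁ b) (inj₂ c) = inj₂ (inj₁ (uB x w a c))

pathDistance : (n : ℕ) → GraphDistance (pathGraph n)
pathDistance n = record
  { dist     = λ x z → ∣ toℕ x - toℕ z ∣
  ; walk     = straight
  ; shortest = walk-bound (λ x z → ∣ toℕ x - toℕ z ∣) (λ z → ∣n-n∣≡0 (toℕ z))
                 (λ {x} {y} z e → ∣-∣-step (toℕ x) (toℕ y) (toℕ z) (path-edge-length e))
  }
  where
  open Walks (pathGraph n)
  open PathEdges (λ e → e)

-- The vertices at distance d from z in P_n are z + d and z - d.
path-spheres : (n : ℕ) → SmallSpheres (pathDistance n)
path-spheres n z d = two-classes side above-unique below-unique
  where
  above below : Fin n → Set
  above x = toℕ x ≡ toℕ z + d
  below x = toℕ x + d ≡ toℕ z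
  side : ∀ x → ∣ toℕ x - toℕ z ∣ ≡ d → above x ⊎ below x
  side x refl = ∣-∣-cases (toℕ x) (toℕ z)
  above-unique : Unique above
  above-unique x y ax ay = toℕ-injective (trans ax (sym ay))
  below-unique : Unique below
  below-unique x y bx by = toℕ-injective (+-cancelʳ-≡ _ _ _ (trans bx (sym by)))

∸-step : ∀ n e e′ → e′ ≤ suc e → n ∸ e ≤ suc (n ∸ e′)
∸-step zero    e       e′             _          = ≤-trans (≤-reflexive (0∸n≡0 e)) z≤n
∸-step (suc n) zero    zero           _          = n≤1+n _
∸-step (suc n) zero    (suc zero)     _          = ≤-refl
∸-step (suc n) zero    (suc (suc e′)) (s≤s ())
∸-step (suc n) (suc e) zero           _          = ≤-trans (m∸n≤m n e) (≤-trans (n≤1+n n) (n≤1+n _))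
∸-step (suc n) (suc e) (suc e′)       (s≤s e′≤) = ∸-step n e e′ e′≤

-- The two ends of the edge {0, n-1}: min (a, b + 1) and min (b, a + 1) differ by at most one.
swap-bound : ∀ a b → a ⊓ suc b ≤ suc (b ⊓ suc a)
swap-bound a b = subst (_≤ suc (b ⊓ suc a)) (⊓-comm (suc b) a) (⊓-monoʳ-≤ (suc b) (m≤n⇒m≤1+n (n≤1+n a)))

module Cycle (n : ℕ) (3≤n : 3 ≤ n) where
  G : Graph n
  G = cycleGraph n 3≤n
  open Walks G
  open PathEdges inj₁

  linear cyclic : Fin n → Fin n → ℕ
  linear x z = ∣ toℕ x - toℕ z ∣
  cyclic x z = linear x z ⊓ (n ∸ linear x z)

  last : ℕ
  last = n ∸ 1

  n≡1+last : n ≡ suc last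
  n≡1+last = sym (m+[n∸m]≡n (≤-trans (s≤s z≤n) 3≤n))

  first-vertex last-vertex : Fin n
  first-vertex = fromℕ< (≤-trans (s≤s z≤n) 3≤n)
  last-vertex  = fromℕ< (≤-reflexive (sym n≡1+last))

  ≤last : ∀ (x : Fin n) → toℕ x ≤ last
  ≤last x = ≤-pred (subst (toℕ x <_) n≡1+last (toℕ<n x))

  around-from : ∀ x z t → toℕ x + t ≡ toℕ z → Walk G x z (n ∸ t)
  around-from x z t x+t≡z = subst (Walk G x z) length (down-to-first ++ʷ step wrap-edge down-from-last)
    where
    down-to-first : Walk G x first-vertex (toℕ x)
    down-to-first = reverse (climb (toℕ x) first-vertex x (cong (_+ toℕ x) (sym (toℕ-fromℕ< _))))
    wrap-edge : Adj G first-vertex last-vertex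
    wrap-edge = inj₂ (inj₁ (toℕ-fromℕ< _ , toℕ-fromℕ< _))
    down-from-last : Walk G last-vertex z (last ∸ toℕ z)
    down-from-last = reverse (climb (last ∸ toℕ z) z last-vertex
                       (trans (toℕ-fromℕ< _) (sym (m+[n∸m]≡n (≤last z)))))
    length : toℕ x + suc (last ∸ toℕ z) ≡ n ∸ t
    length = begin
      toℕ x + suc (last ∸ toℕ z)                ≡⟨ cong (λ v → toℕ x + suc (last ∸ v)) x+t≡z ⟨
      toℕ x + suc (last ∸ (toℕ x + t))          ≡⟨ +-suc (toℕ x) _ ⟩
      suc (toℕ x + (last ∸ (toℕ x + t)))        ≡⟨ m+n∸n≡m (suc (toℕ x + r)) t ⟨
      suc (toℕ x + r) + t ∸ t                   ≡⟨ cong (_∸ t) (reassoc (toℕ x) r t) ⟩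
      suc (toℕ x + t + r) ∸ t                   ≡⟨ cong (λ v → suc v ∸ t) (m+[n∸m]≡n (subst (_≤ last) (sym x+t≡z) (≤last z))) ⟩
      suc last ∸ t                              ≡⟨ cong (_∸ t) n≡1+last ⟨
      n ∸ t                                     ∎
      where
      open ≡-Reasoning
      r : ℕ
      r = last ∸ (toℕ x + t)
      reassoc : ∀ a r t → suc (a + r) + t ≡ suc (a + t + r)
      reassoc = solve-∀

  around : ∀ x z → Walk G x z (n ∸ linear x z)
  around x z with ∣-∣-cases (toℕ x) (toℕ z)
  ... | inj₂ e = around-from x z _ e
  ... | inj₁ e = reverse (subst (λ v → Walk G z x (n ∸ v)) (∣-∣-comm (toℕ z) (toℕ x))
                   (around-from z x _ (trans (cong (toℕ z +_) (∣-∣-comm (toℕ z) (toℕ x))) (sym e))))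

  walk : ∀ x z → Walk G x z (cyclic x z)
  walk x z with ⊓-sel (linear x z) (n ∸ linear x z)
  ... | inj₁ e = subst (Walk G x z) (sym e) (straight x z)
  ... | inj₂ e = subst (Walk G x z) (sym e) (around x z)

  module WrapEnds (z : Fin n) where
    c u : ℕ
    c = toℕ z
    u = last ∸ c

    n≡c+1+u : n ≡ c + suc u
    n≡c+1+u = trans n≡1+last (trans (cong suc (sym (m+[n∸m]≡n (≤last z)))) (sym (+-suc c u)))

    from-first : ∀ x → toℕ x ≡ 0 → cyclic x z ≡ c ⊓ suc u
    from-first x x≡0 rewrite x≡0 = cong (c ⊓_) (trans (cong (_∸ c) n≡c+1+u) (m+n∸m≡n c (suc u)))

    from-last : ∀ x → toℕ x ≡ last → cyclic x z ≡ u ⊓ suc c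
    from-last x x≡last = trans (cong (λ v → v ⊓ (n ∸ v)) linear≡u)
                               (cong (u ⊓_) (trans (cong (_∸ u) n≡u+1+c) (m+n∸m≡n u (suc c))))
      where
      n≡u+1+c : n ≡ u + suc c
      n≡u+1+c = trans n≡c+1+u (trans (+-suc c u) (trans (cong suc (+-comm c u)) (sym (+-suc u c))))
      linear≡u : linear x z ≡ u
      linear≡u = trans (cong ∣_- c ∣ (trans x≡last (sym (m+[n∸m]≡n (≤last z))))) (trans (∣-∣-comm (c + u) c) (∣m-m+n∣≡n c u))

  -- along a path edge both arcs change by at most one; along the wrap edge use WrapEnds
  step-bound : ∀ {x y} z → CycleAdj x y → cyclic x z ≤ suc (cyclic y z)
  step-bound {x} {y} z (inj₁ e) =
    ⊓-mono-≤ (∣-∣-step (toℕ x) (toℕ y) (toℕ z) (path-edge-length e))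
             (∸-step n (linear x z) (linear y z)
                     (∣-∣-step (toℕ y) (toℕ x) (toℕ z) (trans (∣-∣-comm (toℕ y) (toℕ x)) (path-edge-length e))))
  step-bound {x} {y} z (inj₂ (inj₁ (x≡0 , y≡last))) =
    subst₂ (λ p q → p ≤ suc q) (sym (from-first x x≡0)) (sym (from-last y y≡last)) (swap-bound c u)
    where open WrapEnds z
  step-bound {x} {y} z (inj₂ (inj₂ (y≡0 , x≡last))) =
    subst₂ (λ p q → p ≤ suc q) (sym (from-last x x≡last)) (sym (from-first y y≡0)) (swap-bound u c)
    where open WrapEnds z

  distance : GraphDistance G
  distance = record
    { dist     = cyclic
    ; walk     = walk
    ; shortest = walk-bound cyclic (λ z → cong (λ v → v ⊓ (n ∸ v)) (∣n-n∣≡0 (toℕ z))) step-bound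
    }

  -- no vertex exceeds another by n, so distinct vertices are incongruent mod n
  no-wrap : ∀ {a b} → b < n → a + n ≡ b → ⊥
  no-wrap {a} b<n a+n≡b = <-irrefl refl (≤-trans b<n (≤-trans (m≤n+m n a) (≤-reflexive a+n≡b)))

  -- The vertices at distance d from z in C_n are z + d and z - d (mod n).
  spheres : SmallSpheres distance
  spheres z d = two-classes side forward-unique backward-unique
    where
    c : ℕ
    c = toℕ z
    forward backward : Fin n → Set
    forward  x = toℕ x ≡ c + d ⊎ toℕ x + n ≡ c + d
    backward x = toℕ x + d ≡ c ⊎ toℕ x + d ≡ c + n

    forward-unique : Unique forward
    forward-unique x y (inj₁ a) (inj₁ b) = toℕ-injective (trans a (sym b))
    forward-unique x y (inj₂ a) (inj₂ b) = toℕ-injective (+-cancelʳ-≡ _ _ _ (trans a (sym b)))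
    forward-unique x y (inj₁ a) (inj₂ b) = ⊥-elim (no-wrap (toℕ<n x) (trans b (sym a)))
    forward-unique x y (inj₂ a) (inj₁ b) = ⊥-elim (no-wrap (toℕ<n y) (trans a (sym b)))

    shift : ∀ a b → a + d ≡ c → b + d ≡ c + n → a + n ≡ b
    shift a b a+d≡c b+d≡c+n = +-cancelʳ-≡ d _ _ (begin
      a + n + d  ≡⟨ +-assoc a n d ⟩
      a + (n + d) ≡⟨ cong (a +_) (+-comm n d) ⟩
      a + (d + n) ≡⟨ +-assoc a d n ⟨
      a + d + n  ≡⟨ cong (_+ n) a+d≡c ⟩
      c + n      ≡⟨ b+d≡c+n ⟨
      b + d      ∎)
      where open ≡-Reasoning

    backward-unique : Unique backward
    backward-unique x y (inj₁ a) (inj₁ b) = toℕ-injective (+-cancelʳ-≡ _ _ _ (trans a (sym b)))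
    backward-unique x y (inj₂ a) (inj₂ b) = toℕ-injective (+-cancelʳ-≡ _ _ _ (trans a (sym b)))
    backward-unique x y (inj₁ a) (inj₂ b) = ⊥-elim (no-wrap (toℕ<n y) (shift (toℕ x) (toℕ y) a b))
    backward-unique x y (inj₂ a) (inj₁ b) = ⊥-elim (no-wrap (toℕ<n x) (shift (toℕ y) (toℕ x) b a))

    long-arc : ∀ x → cyclic x z ≡ d → cyclic x z ≡ n ∸ linear x z → linear x z + d ≡ n
    long-arc x dist≡d long = trans (cong (linear x z +_) (trans (sym dist≡d) long))
                                   (m+[n∸m]≡n (<⇒≤ (∣-∣<n (toℕ<n x) (toℕ<n z))))

    side : ∀ x → cyclic x z ≡ d → forward x ⊎ backward x
    side x dist≡d with ⊓-sel (linear x z) (n ∸ linear x z) | ∣-∣-cases (toℕ x) c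
    ... | inj₁ short | inj₁ x≡c+e = inj₁ (inj₁ (subst (λ t → toℕ x ≡ c + t) (trans (sym short) dist≡d) x≡c+e))
    ... | inj₁ short | inj₂ x+e≡c = inj₂ (inj₁ (subst (λ t → toℕ x + t ≡ c) (trans (sym short) dist≡d) x+e≡c))
    ... | inj₂ long  | inj₁ x≡c+e = inj₂ (inj₂ (begin
      toℕ x + d                ≡⟨ cong (_+ d) x≡c+e ⟩
      c + linear x z + d       ≡⟨ +-assoc c (linear x z) d ⟩
      c + (linear x z + d)     ≡⟨ cong (c +_) (long-arc x dist≡d long) ⟩
      c + n                    ∎))
      where open ≡-Reasoning
    ... | inj₂ long  | inj₂ x+e≡c = inj₁ (inj₂ (begin
      toℕ x + n                ≡⟨ cong (toℕ x +_) (long-arc x dist≡d long) ⟨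
      toℕ x + (linear x z + d) ≡⟨ +-assoc (toℕ x) (linear x z) d ⟨
      toℕ x + linear x z + d   ≡⟨ cong (_+ d) x+e≡c ⟩
      c + d                    ∎))
      where open ≡-Reasoning

  perceived-as-line : ∀ x z → 1 ≤ toℕ z → suc (suc (toℕ z)) ≤ n → cyclic x z ⊓ 2 ≡ ∣ toℕ x - toℕ z ∣ ⊓ 2
  perceived-as-line x z 1≤c c+2≤n = begin
    (e ⊓ (n ∸ e)) ⊓ 2   ≡⟨ ⊓-assoc e (n ∸ e) 2 ⟩
    e ⊓ ((n ∸ e) ⊓ 2)   ≡⟨ cong (e ⊓_) (m≥n⇒m⊓n≡n (m+n≤o⇒m≤o∸n 2 short-arc)) ⟩
    e ⊓ 2               ∎
    where
    open ≡-Reasoning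
    e : ℕ
    e = linear x z
    short-arc : 2 + e ≤ n
    short-arc with ∣-∣-cases (toℕ x) (toℕ z)
    ... | inj₁ x≡c+e = ≤-trans (s≤s (≤-trans (+-monoˡ-≤ e 1≤c) (≤-reflexive (sym x≡c+e)))) (toℕ<n x)
    ... | inj₂ x+e≡c = ≤-trans (s≤s (s≤s (≤-trans (m≤n+m e (toℕ x)) (≤-reflexive x+e≡c)))) c+2≤n

-- Upper bound: broadcasts of strength 1 on the line

-- What a broadcaster of strength 1 at c perceives of a vertex a of a path:
-- the distance |a - c| truncated at 2.
near : ℕ → ℕ → ℕ
near a c = ∣ a - c ∣ ⊓ 2

LineResolving : ℕ → (ℕ → ℕ) → Set
LineResolving n F =
  ∀ a b → a < n → b < n → a ≢ b → Σ ℕ λ c → c < n × F c ≡ 1 × near a c ≢ near b c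

line-resolving⇒resolving : ∀ {n} {G : Graph n} (D : GraphDistance G) (F : ℕ → ℕ) →
  (∀ x z → F (toℕ z) ≡ 1 → GraphDistance.dist D x z ⊓ 2 ≡ near (toℕ x) (toℕ z)) →
  LineResolving n F → Resolving G (λ i → F (toℕ i))
line-resolving⇒resolving {n} {G} D F agree line x y x≢y
  with line (toℕ x) (toℕ y) (toℕ<n x) (toℕ<n y) (λ e → x≢y (toℕ-injective e))
... | c , c<n , Fc≡1 , differ =
  z , ≤-reflexive (sym Fz≡1) , dist x z ⊓ 2 , dist y z ⊓ 2 ,
  subst (λ i → TDist G i x z (dist x z ⊓ 2)) (sym Fz≡1) (truncated 1 x z) ,
  subst (λ i → TDist G i y z (dist y z ⊓ 2)) (sym Fz≡1) (truncated 1 y z) ,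
  (λ same → differ (trans (sym (seen x)) (trans same (seen y))))
  where
  open GraphDistance D
  z : Fin n
  z = fromℕ< c<n
  Fz≡1 : F (toℕ z) ≡ 1
  Fz≡1 = trans (cong F (toℕ-fromℕ< c<n)) Fc≡1
  seen : ∀ v → dist v z ⊓ 2 ≡ near (toℕ v) c
  seen v = trans (agree v z Fz≡1) (cong (near (toℕ v)) (toℕ-fromℕ< c<n))

straddle : ∀ x y z → near x z ≤ 1 → near x z ≡ near y z → x ≢ y →
  (z ≡ suc y × x ≡ suc z) ⊎ (z ≡ suc x × y ≡ suc z)
straddle x y z close same x≢y = by-sides (∣-∣-cases x z) (∣-∣-cases y z)
  where
  e : ℕ
  e = ∣ x - z ∣
  untruncated : ∀ m → m ⊓ 2 ≤ 1 → m ⊓ 2 ≡ m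
  untruncated zero          _ = refl
  untruncated (suc zero)    _ = refl
  untruncated (suc (suc m)) (s≤s ())
  x-dist : near x z ≡ e
  x-dist = untruncated e close
  y-dist : ∣ y - z ∣ ≡ e
  y-dist = trans (sym (untruncated ∣ y - z ∣ (subst (_≤ 1) same close))) (trans (sym same) x-dist)
  e≤1 : e ≤ 1
  e≤1 = subst (_≤ 1) x-dist close
  by-sides : x ≡ z + e ⊎ x + e ≡ z → y ≡ z + ∣ y - z ∣ ⊎ y + ∣ y - z ∣ ≡ z →
    (z ≡ suc y × x ≡ suc z) ⊎ (z ≡ suc x × y ≡ suc z)
  by-sides (inj₁ xa) (inj₁ ya) rewrite y-dist = ⊥-elim (x≢y (trans xa (sym ya)))
  by-sides (inj₂ xb) (inj₂ yb) rewrite y-dist = ⊥-elim (x≢y (+-cancelʳ-≡ _ _ _ (trans xb (sym yb))))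
  by-sides (inj₁ xa) (inj₂ yb) rewrite y-dist with e | e≤1
  ... | zero  | _ = ⊥-elim (x≢y (trans xa (trans (+-identityʳ z) (trans (sym yb) (+-identityʳ y)))))
  ... | suc zero | _ = inj₁ (sym (trans (+-comm 1 y) yb) , trans xa (+-comm z 1))
  ... | suc (suc _) | s≤s ()
  by-sides (inj₂ xb) (inj₁ ya) rewrite y-dist with e | e≤1
  ... | zero  | _ = ⊥-elim (x≢y (trans (sym (+-identityʳ x)) (trans xb (trans (sym (+-identityʳ z)) (sym ya)))))
  ... | suc zero | _ = inj₂ (sym (trans (+-comm 1 x) xb) , trans ya (+-comm z 1))
  ... | suc (suc _) | s≤s ()

record Pattern (n : ℕ) : Set where
  field
    F         : ℕ → ℕ
    gap       : ℕ
    dominated : ∀ {x} → x < n → x ≢ gap → ∃ λ z → z < n × F z ≡ 1 × near x z ≤ 1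
    separated : ∀ {z} → suc (suc z) < n → F (suc z) ≡ 1 →
                ∃ λ w → w < n × F w ≡ 1 × near z w ≢ near (suc (suc z)) w
    interior  : ∀ {c} → c < n → F c ≡ 1 → 1 ≤ c × suc (suc c) ≤ n
    weight    : sumFin {n} (λ i → F (toℕ i)) ≡ (2 * n + 2) / 5

  Separated : ℕ → ℕ → Set
  Separated a b = Σ ℕ λ c → c < n × F c ≡ 1 × near a c ≢ near b c

  flip : ∀ {a b} → Separated a b → Separated b a
  flip (c , c<n , Fc≡1 , differ) = c , c<n , Fc≡1 , (λ e → differ (sym e))

  -- A broadcaster z within distance 1 of a separates a from b unless a and b
  -- are the two neighbours of z, in which case `separated` applies.
  resolve-near : ∀ a b → a < n → b < n → a ≢ b →
    (∃ λ z → z < n × F z ≡ 1 × near a z ≤ 1) → Separated a b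
  resolve-near a b a<n b<n a≢b (z , z<n , Fz≡1 , close) with near a z ≟ near b z
  ... | no differ = z , z<n , Fz≡1 , differ
  ... | yes same with straddle a b z close same a≢b
  ...   | inj₁ (refl , refl) = flip {b} {a} (separated a<n Fz≡1)
  ...   | inj₂ (refl , refl) = separated b<n Fz≡1

  -- Every pattern resolves the segment, using a dominating broadcaster of a
  -- or, if a is the gap, of b.
  resolves : LineResolving n F
  resolves a b a<n b<n a≢b with a ≟ gap
  ... | no  a≢gap = resolve-near a b a<n b<n a≢b (dominated a<n a≢gap)
  ... | yes a≡gap = flip {b} {a} (resolve-near b a b<n a<n (λ e → a≢b (sym e))
                           (dominated b<n (λ b≡gap → a≢b (trans a≡gap (sym b≡gap)))))

-- Small patterns are verified by evaluation: every condition of a pattern is a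
-- bounded, hence decidable, statement.
module PatternCheck (n : ℕ) (F : ℕ → ℕ) (gap : ℕ) where
  dominated? : Dec (∀ {x} → x < n → x ≢ gap → ∃ λ z → z < n × F z ≡ 1 × near x z ≤ 1)
  dominated? = allUpTo? (λ x → ¬? (x ≟ gap) →-dec anyUpTo? (λ z → (F z ≟ 1) ×-dec (near x z ≤? 1)) n) n

  separated? : Dec (∀ {z} → z < n → suc (suc z) < n → F (suc z) ≡ 1 →
                    ∃ λ w → w < n × F w ≡ 1 × near z w ≢ near (suc (suc z)) w)
  separated? = allUpTo? (λ z → suc (suc z) <? n →-dec (F (suc z) ≟ 1 →-dec
                 anyUpTo? (λ w → (F w ≟ 1) ×-dec ¬? (near z w ≟ near (suc (suc z)) w)) n)) n

  interior? : Dec (∀ {c} → c < n → F c ≡ 1 → 1 ≤ c × suc (suc c) ≤ n)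
  interior? = allUpTo? (λ c → F c ≟ 1 →-dec ((1 ≤? c) ×-dec (suc (suc c) ≤? n))) n

  weight? : Dec (sumFin {n} (λ i → F (toℕ i)) ≡ (2 * n + 2) / 5)
  weight? = sumFin {n} (λ i → F (toℕ i)) ≟ (2 * n + 2) / 5

  checked : True (dominated? ×-dec separated? ×-dec interior? ×-dec weight?) → Pattern n
  checked ok with toWitness ok
  ... | dom , sep , int , wt = record
    { F = F ; gap = gap ; dominated = dom
    ; separated = λ {z} 2+z<n → sep (<-trans (m<n+m z (s≤s z≤n)) 2+z<n) 2+z<n
    ; interior = int ; weight = wt }

prepend : (ℕ → ℕ) → ℕ → ℕ
prepend F 0 = 0
prepend F 1 = 1
prepend F 2 = 0
prepend F 3 = 1
prepend F 4 = 0
prepend F (suc (suc (suc (suc (suc i))))) = F i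

weight-step : ∀ n → (2 * (5 + n) + 2) / 5 ≡ 2 + (2 * n + 2) / 5
weight-step n = begin
  (2 * (5 + n) + 2) / 5  ≡⟨ cong (_/ 5) (expand n) ⟩
  (10 + t) / 5           ≡⟨ m/n≡1+[m∸n]/n {10 + t} {5} (m≤m+n 5 (5 + t)) ⟩
  suc ((5 + t) / 5)      ≡⟨ cong suc (m/n≡1+[m∸n]/n {5 + t} {5} (m≤m+n 5 t)) ⟩
  2 + t / 5              ∎
  where
  open ≡-Reasoning
  t : ℕ
  t = 2 * n + 2
  expand : ∀ n → 2 * (5 + n) + 2 ≡ 10 + (2 * n + 2)
  expand = solve-∀

extend : ∀ {n} → Pattern n → Pattern (5 + n)
extend {n} P = record
  { F = prepend F ; gap = 5 + gap
  ; dominated = dominated′ ; separated = separated′ ; interior = interior′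
  ; weight = trans (cong (2 +_) weight) (sym (weight-step n)) }
  where
  open Pattern P
  1<5+n : 1 < 5 + n
  1<5+n = s≤s (s≤s z≤n)
  3<5+n : 3 < 5 + n
  3<5+n = s≤s (s≤s (s≤s (s≤s z≤n)))

  dominated′ : ∀ {x} → x < 5 + n → x ≢ 5 + gap → ∃ λ z → z < 5 + n × prepend F z ≡ 1 × near x z ≤ 1
  dominated′ {0} _ _ = 1 , 1<5+n , refl , s≤s z≤n
  dominated′ {1} _ _ = 1 , 1<5+n , refl , z≤n
  dominated′ {2} _ _ = 1 , 1<5+n , refl , s≤s z≤n
  dominated′ {3} _ _ = 3 , 3<5+n , refl , z≤n
  dominated′ {4} _ _ = 3 , 3<5+n , refl , s≤s z≤n
  dominated′ {suc (suc (suc (suc (suc x))))} (s≤s (s≤s (s≤s (s≤s (s≤s x<n))))) x≢gap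
    with dominated x<n (λ e → x≢gap (cong (5 +_) e))
  ... | z , z<n , Fz≡1 , close = 5 + z , s≤s (s≤s (s≤s (s≤s (s≤s z<n)))) , Fz≡1 , close

  separated′ : ∀ {z} → suc (suc z) < 5 + n → prepend F (suc z) ≡ 1 →
               ∃ λ w → w < 5 + n × prepend F w ≡ 1 × near z w ≢ near (suc (suc z)) w
  separated′ {0} _ _ = 3 , 3<5+n , refl , λ ()
  separated′ {1} _ ()
  separated′ {2} _ _ = 1 , 1<5+n , refl , λ ()
  separated′ {3} _ ()
  separated′ {4} (s≤s (s≤s (s≤s (s≤s (s≤s 1<n))))) F0≡1 with interior (<-trans (s≤s z≤n) 1<n) F0≡1
  ... | () , _
  separated′ {suc (suc (suc (suc (suc z))))} (s≤s (s≤s (s≤s (s≤s (s≤s 2+z<n))))) Fz≡1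
    with separated 2+z<n Fz≡1
  ... | w , w<n , Fw≡1 , differ = 5 + w , s≤s (s≤s (s≤s (s≤s (s≤s w<n)))) , Fw≡1 , differ

  interior′ : ∀ {c} → c < 5 + n → prepend F c ≡ 1 → 1 ≤ c × suc (suc c) ≤ 5 + n
  interior′ {0} _ ()
  interior′ {1} _ _ = s≤s z≤n , s≤s (s≤s (s≤s z≤n))
  interior′ {2} _ ()
  interior′ {3} _ _ = s≤s z≤n , s≤s (s≤s (s≤s (s≤s (s≤s z≤n))))
  interior′ {4} _ ()
  interior′ {suc (suc (suc (suc (suc c))))} (s≤s (s≤s (s≤s (s≤s (s≤s c<n))))) Fc≡1 =
    s≤s z≤n , s≤s (s≤s (s≤s (s≤s (s≤s (proj₂ (interior c<n Fc≡1))))))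

patternFor : ∀ k → Pattern (4 + k)
patternFor 0 = PatternCheck.checked 4 (λ { 1 → 1 ; 2 → 1 ; _ → 0 }) 4 tt
patternFor 1 = PatternCheck.checked 5 (λ { 1 → 1 ; 3 → 1 ; _ → 0 }) 5 tt
patternFor 2 = PatternCheck.checked 6 (λ { 1 → 1 ; 3 → 1 ; _ → 0 }) 5 tt
patternFor 3 = PatternCheck.checked 7 (λ { 1 → 1 ; 3 → 1 ; 5 → 1 ; _ → 0 }) 7 tt
patternFor 4 = PatternCheck.checked 8 (λ { 1 → 1 ; 3 → 1 ; 5 → 1 ; _ → 0 }) 7 tt
patternFor (suc (suc (suc (suc (suc k))))) = extend (patternFor k)

bdim-from-pattern : ∀ {n} {G : Graph n} (D : GraphDistance G) → SmallSpheres D → (P : Pattern n) →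
  (∀ x z → Pattern.F P (toℕ z) ≡ 1 → GraphDistance.dist D x z ⊓ 2 ≡ near (toℕ x) (toℕ z)) →
  IsBdim G ((2 * n + 2) / 5)
bdim-from-pattern D spheres P line-like =
  ( (λ i → F (toℕ i)) , line-resolving⇒resolving D F line-like resolves , weight )
  , λ f resolving → LowerBound.lower-bound D spheres f resolving
  where open Pattern P

-- P_n and C_n have small spheres, and the pattern for n sees both as the line
-- (for C_n because its broadcasters avoid the ends).
theorem2p13 : (n : ℕ) → (h : 4 ≤ n) →
    IsBdim (pathGraph n) ((2 * n + 2) / 5)
    × IsBdim (cycleGraph n (≤-trans (n≤1+n 3) h)) ((2 * n + 2) / 5)
theorem2p13 0 ()
theorem2p13 1 (s≤s ())
theorem2p13 2 (s≤s (s≤s ()))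
theorem2p13 3 (s≤s (s≤s (s≤s ())))
theorem2p13 n@(suc (suc (suc (suc k)))) h =
    bdim-from-pattern (pathDistance n) (path-spheres n) P (λ x z _ → refl)
  , bdim-from-pattern distance spheres P
      (λ x z Fz≡1 → perceived-as-line x z (proj₁ (interior (toℕ<n z) Fz≡1)) (proj₂ (interior (toℕ<n z) Fz≡1)))
  where
  P : Pattern n
  P = patternFor k
  open Pattern P
  open Cycle n (≤-trans (n≤1+n 3) h)
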